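{- Let $R$ be a ring, $a\in R$, $M$ a $p$-complete $R$-module, and $\{\phi_n\}_{n\ge0}\subset\mathrm{End}_R(M)$ with $\phi_0=\mathrm{id}_M$ (such that the series below make sense). Then the following are equivalent: (1) for every $n\ge0$, \[\phi_n=\sum_{l,m\ge0}\phi_m\circ\phi_{l+n}\,(1+aX)^{ -l-n}(-1)^lX^{[l]}X^{[m]};\] (2) for every $n\ge1$, $\phi_n=\prod_{i=0}^{n-1}(\phi_1-ia)$.
   Context: $X$ is a formal variable with divided powers, $X^{[m]}=X^m/m!$; the identity in (1) is an identity of $\mathrm{End}_R(M)$-valued (completed) pd-power series in $X$ (equivalently in $\mathrm{End}_R(M)\widehat\otimes_R R\{X\}^\wedge_{\mathrm{pd}}$, $R$ being $p$-complete). -}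

module Defs where

open import Level using (Level; _⊔_)
open import Data.Nat using (ℕ; zero; suc; _∸_; _≡ᵇ_; _!)
open import Data.Nat.Combinatorics using (_C_)
open import Data.Bool using (if_then_else_)
open import Data.Product using (∃)
open import Algebra.Bundles using (CommutativeRing)
open import Algebra.Module.Bundles using (Module)

module _ {r ℓr m ℓm : Level} (R : CommutativeRing r ℓr) (M : Module R m ℓm) where
  open CommutativeRing R
  open Module M

  natR : ℕ → Carrier
  natR zero    = 0#
  natR (suc n) = 1# + natR n

  powR : Carrier → ℕ → Carrier
  powR x zero    = 1#
  powR x (suc n) = powR x n * x

  -- p-completeness of M:  M → lim_n M/p^n M is a bijection,
  -- i.e. M is p-adically separated and p-adically complete.
  InPowM : ℕ → ℕ → Carrierᴹ → Set (m ⊔ ℓm)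
  InPowM p n x = ∃ λ y → x ≈ᴹ (powR (natR p) n *ₗ y)

  record IsPComplete (p : ℕ) : Set (m ⊔ ℓm) where
    field
      separated : ∀ x → (∀ n → InPowM p n x) → x ≈ᴹ 0ᴹ
      complete  : (s : ℕ → Carrierᴹ) →
                  (∀ n → InPowM p n (s (suc n) +ᴹ (-ᴹ s n))) →
                  ∃ λ x → ∀ n → InPowM p n (x +ᴹ (-ᴹ s n))

  record End : Set (r ⊔ m ⊔ ℓm) where
    field
      fun    : Carrierᴹ → Carrierᴹ
      cong   : ∀ {x y} → x ≈ᴹ y → fun x ≈ᴹ fun y
      +-hom  : ∀ x y → fun (x +ᴹ y) ≈ᴹ (fun x +ᴹ fun y)
      *ₗ-hom : ∀ c x → fun (c *ₗ x) ≈ᴹ (c *ₗ fun x)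
  open End public

  Map : Set m
  Map = Carrierᴹ → Carrierᴹ

  idM : Map
  idM x = x

  zeroM : Map
  zeroM _ = 0ᴹ

  _+M_ : Map → Map → Map
  (f +M g) x = f x +ᴹ g x

  _∘M_ : Map → Map → Map
  (f ∘M g) x = f (g x)

  _·M_ : Carrier → Map → Map
  (c ·M f) x = c *ₗ f x

  sumM : ℕ → (ℕ → Map) → Map
  sumM zero    f = zeroM
  sumM (suc n) f = sumM n f +M f n

  -- End_R(M)-valued pd-power series  ∑_k s k X^[k]
  -- (s k = coefficient of X^[k]); the multiplication uses
  -- X^[i] X^[j] = C(i+j,i) X^[i+j].
  PDSeries : Set m
  PDSeries = ℕ → Map

  _≈S_ : PDSeries → PDSeries → Set (m ⊔ ℓm)
  s ≈S t = ∀ k x → s k x ≈ᴹ t k x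

  constS : Map → PDSeries
  constS f zero    = f
  constS f (suc k) = zeroM

  scalarS : Carrier → PDSeries
  scalarS c = constS (c ·M idM)

  Xpd : ℕ → PDSeries
  Xpd l k = if k ≡ᵇ l then idM else zeroM

  _⋆_ : PDSeries → PDSeries → PDSeries
  (s ⋆ t) k = sumM (suc k) (λ i → natR (k C i) ·M (s i ∘M t (k ∸ i)))

  powS : PDSeries → ℕ → PDSeries
  powS s zero    = constS idM
  powS s (suc n) = powS s n ⋆ s

  -- (1 + aX)^{-1} = ∑_j (-a)^j X^j = ∑_j (-1)^j j! a^j X^[j]
  inv1+aX : Carrier → PDSeries
  inv1+aX a j = (powR (- 1#) j * (natR (j !) * powR a j)) ·M idM

  invPow : Carrier → ℕ → PDSeries
  invPow a N = powS (inv1+aX a) N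

  -- ∑_{l,m ≥ 0} t l m, for a family with t l m ∈ X^[l+m]·(series)
  -- (so only finitely many terms contribute to each coefficient).
  doubleSum : (ℕ → ℕ → PDSeries) → PDSeries
  doubleSum t k = sumM (suc k) (λ l → sumM (suc (k ∸ l)) (λ m → t l m k))

  term : Carrier → (ℕ → End) → ℕ → ℕ → ℕ → PDSeries
  term a φ n l m =
    constS (fun (φ m) ∘M fun (φ (l Data.Nat.+ n)))
      ⋆ (invPow a (l Data.Nat.+ n) ⋆ (scalarS (powR (- 1#) l) ⋆ (Xpd l ⋆ Xpd m)))

  Condition1 : Carrier → (ℕ → End) → Set (m ⊔ ℓm)
  Condition1 a φ = ∀ n → constS (fun (φ n)) ≈S doubleSum (term a φ n)

  prodFactors : Carrier → (ℕ → End) → ℕ → Map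
  prodFactors a φ zero    = idM
  prodFactors a φ (suc n) =
    prodFactors a φ n ∘M (fun (φ 1) +M ((- (natR n * a)) ·M idM))

  Condition2 : Carrier → (ℕ → End) → Set (m ⊔ ℓm)
  Condition2 a φ = ∀ n → 1 Data.Nat.≤ n → ∀ x → fun (φ n) x ≈ᴹ prodFactors a φ n x

{-# OPTIONS --safe #-}
module Submission where

-- Put Φ = Σ_m φ_m X^[m] and Ψ_n = Σ_l φ_{l+n} (1+aX)^{-l-n} (-1)^l X^[l]; the right-hand side of
-- (1) is the product Φ·Ψ_n, whose constant term is φ_n, so (1) says that Φ·Ψ_n has no terms of
-- positive degree.  The operator D = (1+aX)·d/dX is a derivation with D(1+aX)^{-N} = -Na(1+aX)^{-N}.
-- Condition (2) is equivalent to the recurrence φ_{m+1} = φ_m (φ_1 - m a), which gives DΦ = φ_1 Φ and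
-- DΨ_n = -φ_1 Ψ_n; hence D(Φ·Ψ_n) = 0, and a series killed by D is constant.  Conversely, the
-- coefficient of X^[1] in (1) is exactly the recurrence.

open import Defs
open import Level using (Level; _⊔_)
open import Data.Nat as ℕ using (ℕ; zero; suc; _∸_; _≤_; _<_; _≤′_; z≤n; s≤s)
import Data.Nat.Properties as ℕP
open import Data.Nat.Combinatorics using (_C_; nC1≡n; nCk+nC[k+1]≡[n+1]C[k+1]; k>n⇒nCk≡0; nCk≡nC[n∸k])
open import Data.Bool using (true; false)
open import Data.Product using (_×_; _,_)
open import Data.Nat.Primality using (Prime)
open import Data.Sum using (inj₁; inj₂)
open import Data.Empty using (⊥-elim)
open import Relation.Nullary using (yes; no)
open import Relation.Binary.PropositionalEquality as ≡ using (_≡_; _≢_)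
open import Algebra.Bundles using (CommutativeRing; CommutativeMonoid)
open import Algebra.Module.Bundles using (Module)
import Algebra.Properties.Ring as RingProperties
import Algebra.Module.Properties as ModuleProperties
import Algebra.Properties.CommutativeSemigroup as CommutativeSemigroupProperties
import Algebra.Solver.Ring.NaturalCoefficients.Default as NaturalCoefficientsSolver
import Relation.Binary.Reasoning.Setoid as SetoidReasoning

module _ {r ℓr m ℓm : Level} (R : CommutativeRing r ℓr) (M : Module R m ℓm) where
  open CommutativeRing R
  open Module M
  open RingProperties ring using (-1*x≈-x; -0#≈0#; -‿+-comm; -‿involutive; -‿distribʳ-*)
  module +ᴹ = CommutativeSemigroupProperties (CommutativeMonoid.commutativeSemigroup +ᴹ-commutativeMonoid)
  open ModuleProperties M using (x≈0⇒x*y≈0; y≈0⇒x*y≈0)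
  open NaturalCoefficientsSolver commutativeSemiring using (solve; _:=_; _:+_; _:*_; con)
  open SetoidReasoning ≈ᴹ-setoid

  ι : ℕ → Carrier
  ι = natR R M

  sign : ℕ → Carrier
  sign = powR R M (- 1#)

  ι-homo-+ : ∀ i j → ι (i ℕ.+ j) ≈ ι i + ι j
  ι-homo-+ zero    j = sym (+-identityˡ (ι j))
  ι-homo-+ (suc i) j = trans (+-congˡ (ι-homo-+ i j)) (sym (+-assoc 1# (ι i) (ι j)))

  ι-homo-* : ∀ i j → ι (i ℕ.* j) ≈ ι i * ι j
  ι-homo-* zero    j = sym (zeroˡ (ι j))
  ι-homo-* (suc i) j = trans (ι-homo-+ j (i ℕ.* j))
    (trans (+-cong (sym (*-identityˡ (ι j))) (ι-homo-* i j)) (sym (distribʳ (ι j) 1# (ι i))))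

  ι-pascal : ∀ k i → ι (suc k C suc i) ≈ ι (k C i) + ι (k C suc i)
  ι-pascal k i = trans (reflexive (≡.cong ι (≡.sym (nCk+nC[k+1]≡[n+1]C[k+1] k i)))) (ι-homo-+ (k C i) (k C suc i))

  ι1-*ₗ : ∀ x → ι 1 *ₗ x ≈ᴹ x
  ι1-*ₗ x = ≈ᴹ-trans (*ₗ-congʳ (+-identityʳ 1#)) (*ₗ-identityˡ x)

  x+-1*ₗx≈0 : ∀ x → x +ᴹ (- 1#) *ₗ x ≈ᴹ 0ᴹ
  x+-1*ₗx≈0 x = begin
    x +ᴹ (- 1#) *ₗ x        ≈⟨ +ᴹ-congʳ (≈ᴹ-sym (*ₗ-identityˡ x)) ⟩
    1# *ₗ x +ᴹ (- 1#) *ₗ x  ≈⟨ ≈ᴹ-sym (*ₗ-distribʳ x 1# (- 1#)) ⟩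
    (1# + - 1#) *ₗ x        ≈⟨ *ₗ-congʳ (-‿inverseʳ 1#) ⟩
    0# *ₗ x                 ≈⟨ *ₗ-zeroˡ x ⟩
    0ᴹ                      ∎

  *ₗ-assoc₃ : ∀ c d e x → (c * (d * e)) *ₗ x ≈ᴹ c *ₗ (d *ₗ (e *ₗ x))
  *ₗ-assoc₃ c d e x = ≈ᴹ-trans (*ₗ-assoc c (d * e) x) (*ₗ-congˡ (*ₗ-assoc d e x))

  [1+-1]*x≈0 : ∀ x → (1# + - 1#) * x ≈ 0#
  [1+-1]*x≈0 x = trans (*-congʳ (-‿inverseʳ 1#)) (zeroˡ x)

  -x*-1≈x : ∀ x → (- x) * (- 1#) ≈ x
  -x*-1≈x x = trans (sym (-‿distribʳ-* (- x) 1#)) (trans (-‿cong (*-identityʳ (- x))) (-‿involutive x))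

  0≈p-v+t⇒v≈t+p : ∀ {p v t} → 0ᴹ ≈ᴹ (p +ᴹ (- 1#) *ₗ v) +ᴹ t → v ≈ᴹ t +ᴹ p
  0≈p-v+t⇒v≈t+p {p} {v} {t} 0≈p-v+t = begin
    v                                  ≈⟨ +ᴹ-identityʳ v ⟨
    v +ᴹ 0ᴹ                            ≈⟨ +ᴹ-congˡ 0≈p-v+t ⟩
    v +ᴹ ((p +ᴹ (- 1#) *ₗ v) +ᴹ t)     ≈⟨ +ᴹ-congˡ (≈ᴹ-trans (+ᴹ-congʳ (+ᴹ-comm _ _)) (+ᴹ-assoc _ _ _)) ⟩
    v +ᴹ ((- 1#) *ₗ v +ᴹ (p +ᴹ t))     ≈⟨ +ᴹ-assoc _ _ _ ⟨
    (v +ᴹ (- 1#) *ₗ v) +ᴹ (p +ᴹ t)     ≈⟨ +ᴹ-cong (x+-1*ₗx≈0 v) (+ᴹ-comm p t) ⟩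
    0ᴹ +ᴹ (t +ᴹ p)                     ≈⟨ +ᴹ-identityˡ _ ⟩
    t +ᴹ p                             ∎

  cancel-zeroʳ : ∀ {x y z} → x +ᴹ y ≈ᴹ z → y ≈ᴹ 0ᴹ → x ≈ᴹ z
  cancel-zeroʳ {x} x+y≈z y≈0 = ≈ᴹ-trans (≈ᴹ-sym (≈ᴹ-trans (+ᴹ-congˡ y≈0) (+ᴹ-identityʳ x))) x+y≈z

  ∑ : ℕ → (ℕ → Carrierᴹ) → Carrierᴹ
  ∑ zero    f = 0ᴹ
  ∑ (suc n) f = ∑ n f +ᴹ f n

  sumM-≡-∑ : ∀ n f x → sumM R M n f x ≡ ∑ n (λ i → f i x)
  sumM-≡-∑ zero    f x = ≡.refl
  sumM-≡-∑ (suc n) f x = ≡.cong (_+ᴹ f n x) (sumM-≡-∑ n f x)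

  ∑-cong-< : ∀ n {f g} → (∀ i → i < n → f i ≈ᴹ g i) → ∑ n f ≈ᴹ ∑ n g
  ∑-cong-< zero    f≈g = ≈ᴹ-refl
  ∑-cong-< (suc n) f≈g = +ᴹ-cong (∑-cong-< n (λ i i<n → f≈g i (ℕP.m<n⇒m<1+n i<n))) (f≈g n ℕP.≤-refl)

  ∑-cong : ∀ n {f g} → (∀ i → f i ≈ᴹ g i) → ∑ n f ≈ᴹ ∑ n g
  ∑-cong n f≈g = ∑-cong-< n (λ i _ → f≈g i)

  ∑-zero : ∀ n f → (∀ i → i < n → f i ≈ᴹ 0ᴹ) → ∑ n f ≈ᴹ 0ᴹ
  ∑-zero zero    f f≈0 = ≈ᴹ-refl
  ∑-zero (suc n) f f≈0 = ≈ᴹ-trans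
    (+ᴹ-cong (∑-zero n f (λ i i<n → f≈0 i (ℕP.m<n⇒m<1+n i<n))) (f≈0 n ℕP.≤-refl)) (+ᴹ-identityˡ 0ᴹ)

  ∑-distrib-+ᴹ : ∀ n f g → ∑ n (λ i → f i +ᴹ g i) ≈ᴹ ∑ n f +ᴹ ∑ n g
  ∑-distrib-+ᴹ zero    f g = ≈ᴹ-sym (+ᴹ-identityˡ 0ᴹ)
  ∑-distrib-+ᴹ (suc n) f g = ≈ᴹ-trans (+ᴹ-congʳ (∑-distrib-+ᴹ n f g)) (+ᴹ.interchange _ _ _ _)

  *ₗ-distrib-∑ : ∀ n c f → c *ₗ ∑ n f ≈ᴹ ∑ n (λ i → c *ₗ f i)
  *ₗ-distrib-∑ zero    c f = *ₗ-zeroʳ c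
  *ₗ-distrib-∑ (suc n) c f = ≈ᴹ-trans (*ₗ-distribˡ c (∑ n f) (f n)) (+ᴹ-congʳ (*ₗ-distrib-∑ n c f))

  ∑-unfoldˡ : ∀ n f → ∑ (suc n) f ≈ᴹ f 0 +ᴹ ∑ n (λ i → f (suc i))
  ∑-unfoldˡ zero    f = ≈ᴹ-trans (+ᴹ-identityˡ (f 0)) (≈ᴹ-sym (+ᴹ-identityʳ (f 0)))
  ∑-unfoldˡ (suc n) f = ≈ᴹ-trans (+ᴹ-congʳ (∑-unfoldˡ n f)) (+ᴹ-assoc _ _ _)

  ∑-vanishing-tail : ∀ {n K} f → n ≤ K → (∀ i → n ≤ i → i < K → f i ≈ᴹ 0ᴹ) → ∑ K f ≈ᴹ ∑ n f
  ∑-vanishing-tail f n≤K = go (ℕP.≤⇒≤′ n≤K)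
    where
    go : ∀ {n K} → n ≤′ K → (∀ i → n ≤ i → i < K → f i ≈ᴹ 0ᴹ) → ∑ K f ≈ᴹ ∑ n f
    go ℕ.≤′-refl              tail = ≈ᴹ-refl
    go {n} {suc K} (ℕ.≤′-step n≤′K) tail = begin
      ∑ K f +ᴹ f K ≈⟨ +ᴹ-cong (go n≤′K (λ i n≤i i<K → tail i n≤i (ℕP.m<n⇒m<1+n i<K)))
                              (tail K (ℕP.≤′⇒≤ n≤′K) ℕP.≤-refl) ⟩
      ∑ n f +ᴹ 0ᴹ  ≈⟨ +ᴹ-identityʳ _ ⟩
      ∑ n f        ∎

  ∑-comm : ∀ n k (f : ℕ → ℕ → Carrierᴹ) → ∑ n (λ i → ∑ k (f i)) ≈ᴹ ∑ k (λ j → ∑ n (λ i → f i j))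
  ∑-comm zero    k f = ≈ᴹ-sym (∑-zero k (λ _ → 0ᴹ) (λ _ _ → ≈ᴹ-refl))
  ∑-comm (suc n) k f = ≈ᴹ-trans (+ᴹ-congʳ (∑-comm n k f)) (≈ᴹ-sym (∑-distrib-+ᴹ k _ (f n)))

  ∑-single : ∀ n f j → j < n → (∀ i → i < n → i ≢ j → f i ≈ᴹ 0ᴹ) → ∑ n f ≈ᴹ f j
  ∑-single (suc n) f j j<1+n others with ℕP.m≤n⇒m<n∨m≡n (ℕP.≤-pred j<1+n)
  ... | inj₁ j<n = ≈ᴹ-trans
    (+ᴹ-cong (∑-single n f j j<n (λ i i<n → others i (ℕP.m<n⇒m<1+n i<n)))
             (others n ℕP.≤-refl (λ n≡j → ℕP.<-irrefl (≡.sym n≡j) j<n)))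
    (+ᴹ-identityʳ _)
  ... | inj₂ ≡.refl = ≈ᴹ-trans
    (+ᴹ-congʳ (∑-zero n f (λ i i<n → others i (ℕP.m<n⇒m<1+n i<n) (λ i≡n → ℕP.<-irrefl i≡n i<n))))
    (+ᴹ-identityˡ _)

  record IsLinear (f : Map R M) : Set (r ⊔ m ⊔ ℓm) where
    field
      lin-cong : ∀ {x y} → x ≈ᴹ y → f x ≈ᴹ f y
      lin-+    : ∀ x y → f (x +ᴹ y) ≈ᴹ f x +ᴹ f y
      lin-*ₗ   : ∀ c x → f (c *ₗ x) ≈ᴹ c *ₗ f x
  open IsLinear public

  lin-0 : ∀ {f} → IsLinear f → f 0ᴹ ≈ᴹ 0ᴹ
  lin-0 {f} L = begin
    f 0ᴹ          ≈⟨ lin-cong L (≈ᴹ-sym (*ₗ-zeroˡ 0ᴹ)) ⟩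
    f (0# *ₗ 0ᴹ)  ≈⟨ lin-*ₗ L 0# 0ᴹ ⟩
    0# *ₗ f 0ᴹ    ≈⟨ *ₗ-zeroˡ _ ⟩
    0ᴹ            ∎

  lin-∑ : ∀ {f} → IsLinear f → ∀ n g → f (∑ n g) ≈ᴹ ∑ n (λ i → f (g i))
  lin-∑ L zero    g = lin-0 L
  lin-∑ L (suc n) g = ≈ᴹ-trans (lin-+ L _ _) (+ᴹ-congʳ (lin-∑ L n g))

  End-linear : (φ : End R M) → IsLinear (fun φ)
  End-linear φ = record { lin-cong = End.cong φ ; lin-+ = End.+-hom φ ; lin-*ₗ = End.*ₗ-hom φ }

  id-linear : IsLinear (idM R M)
  id-linear = record { lin-cong = λ x≈y → x≈y ; lin-+ = λ _ _ → ≈ᴹ-refl ; lin-*ₗ = λ _ _ → ≈ᴹ-refl }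

  zero-linear : IsLinear (zeroM R M)
  zero-linear = record
    { lin-cong = λ _ → ≈ᴹ-refl
    ; lin-+    = λ _ _ → ≈ᴹ-sym (+ᴹ-identityˡ 0ᴹ)
    ; lin-*ₗ   = λ c _ → ≈ᴹ-sym (*ₗ-zeroʳ c) }

  ∘-linear : ∀ {f g} → IsLinear f → IsLinear g → IsLinear (_∘M_ R M f g)
  ∘-linear Lf Lg = record
    { lin-cong = λ x≈y → lin-cong Lf (lin-cong Lg x≈y)
    ; lin-+    = λ x y → ≈ᴹ-trans (lin-cong Lf (lin-+ Lg x y)) (lin-+ Lf _ _)
    ; lin-*ₗ   = λ c x → ≈ᴹ-trans (lin-cong Lf (lin-*ₗ Lg c x)) (lin-*ₗ Lf c _) }

  ·-linear : ∀ {f} c → IsLinear f → IsLinear (_·M_ R M c f)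
  ·-linear c Lf = record
    { lin-cong = λ x≈y → *ₗ-congˡ (lin-cong Lf x≈y)
    ; lin-+    = λ x y → ≈ᴹ-trans (*ₗ-congˡ (lin-+ Lf x y)) (*ₗ-distribˡ c _ _)
    ; lin-*ₗ   = λ d x → ≈ᴹ-trans (*ₗ-congˡ (lin-*ₗ Lf d x)) (*ₗ-comm c d _) }

  +-linear : ∀ {f g} → IsLinear f → IsLinear g → IsLinear (_+M_ R M f g)
  +-linear Lf Lg = record
    { lin-cong = λ x≈y → +ᴹ-cong (lin-cong Lf x≈y) (lin-cong Lg x≈y)
    ; lin-+    = λ x y → ≈ᴹ-trans (+ᴹ-cong (lin-+ Lf x y) (lin-+ Lg x y)) (+ᴹ.interchange _ _ _ _)
    ; lin-*ₗ   = λ c x → ≈ᴹ-trans (+ᴹ-cong (lin-*ₗ Lf c x) (lin-*ₗ Lg c x)) (≈ᴹ-sym (*ₗ-distribˡ c _ _)) }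

  sumM-linear : ∀ n f → (∀ i → IsLinear (f i)) → IsLinear (sumM R M n f)
  sumM-linear zero    f L = zero-linear
  sumM-linear (suc n) f L = +-linear (sumM-linear n f L) (L n)

  Series : Set m
  Series = PDSeries R M

  infix  4 _≋_
  infixl 6 _+S_
  infixl 7 _⊛_ _·S_

  _≋_ : Series → Series → Set (m ⊔ ℓm)
  _≋_ = _≈S_ R M

  _⊛_ : Series → Series → Series
  _⊛_ = _⋆_ R M

  _+S_ : Series → Series → Series
  (s +S t) k = _+M_ R M (s k) (t k)

  _·S_ : Carrier → Series → Series
  (c ·S s) k = _·M_ R M c (s k)

  zeroS : Series
  zeroS k = zeroM R M

  _∘S_ : Map R M → Series → Series
  (f ∘S s) k = _∘M_ R M f (s k)

  IsLinearSeries : Series → Set (r ⊔ m ⊔ ℓm)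
  IsLinearSeries s = ∀ k → IsLinear (s k)

  hurwitz : Series → Series → ℕ → Carrierᴹ → Carrierᴹ
  hurwitz s t k x = ∑ (suc k) (λ i → ι (k C i) *ₗ s i (t (k ∸ i) x))

  ⊛-unfold : ∀ s t k x → (s ⊛ t) k x ≡ hurwitz s t k x
  ⊛-unfold s t k x = sumM-≡-∑ (suc k) _ x

  ⊛-coeff₀ : ∀ s t x → (s ⊛ t) 0 x ≈ᴹ s 0 (t 0 x)
  ⊛-coeff₀ s t x = ≈ᴹ-trans (+ᴹ-identityˡ _) (ι1-*ₗ _)

  ⊛-coeff₁ : ∀ s t x → (s ⊛ t) 1 x ≈ᴹ s 0 (t 1 x) +ᴹ s 1 (t 0 x)
  ⊛-coeff₁ s t x = +ᴹ-cong (≈ᴹ-trans (+ᴹ-identityˡ _) (ι1-*ₗ _)) (ι1-*ₗ _)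

  ⊛-termwise : ∀ s t s′ t′ k x → (∀ i → i ≤ k → s i (t (k ∸ i) x) ≈ᴹ s′ i (t′ (k ∸ i) x)) →
               (s ⊛ t) k x ≈ᴹ (s′ ⊛ t′) k x
  ⊛-termwise s t s′ t′ k x eq = begin
    (s ⊛ t) k x       ≡⟨ ⊛-unfold s t k x ⟩
    hurwitz s t k x   ≈⟨ ∑-cong-< (suc k) (λ i i<1+k → *ₗ-congˡ (eq i (ℕP.≤-pred i<1+k))) ⟩
    hurwitz s′ t′ k x ≡⟨ ⊛-unfold s′ t′ k x ⟨
    (s′ ⊛ t′) k x     ∎

  ⊛-termwise-+ : ∀ s t s₁ t₁ s₂ t₂ k x →
                 (∀ i → i ≤ k → s i (t (k ∸ i) x) ≈ᴹ s₁ i (t₁ (k ∸ i) x) +ᴹ s₂ i (t₂ (k ∸ i) x)) →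
                 (s ⊛ t) k x ≈ᴹ (s₁ ⊛ t₁) k x +ᴹ (s₂ ⊛ t₂) k x
  ⊛-termwise-+ s t s₁ t₁ s₂ t₂ k x eq = begin
    (s ⊛ t) k x                           ≡⟨ ⊛-unfold s t k x ⟩
    hurwitz s t k x                       ≈⟨ ∑-cong-< (suc k) (λ i i<1+k → ≈ᴹ-trans (*ₗ-congˡ (eq i (ℕP.≤-pred i<1+k))) (*ₗ-distribˡ _ _ _)) ⟩
    ∑ (suc k) (λ i → _ +ᴹ _)              ≈⟨ ∑-distrib-+ᴹ (suc k) _ _ ⟩
    hurwitz s₁ t₁ k x +ᴹ hurwitz s₂ t₂ k x ≡⟨ ≡.cong₂ _+ᴹ_ (⊛-unfold s₁ t₁ k x) (⊛-unfold s₂ t₂ k x) ⟨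
    (s₁ ⊛ t₁) k x +ᴹ (s₂ ⊛ t₂) k x        ∎

  ⊛-termwise-*ₗ : ∀ c s t s′ t′ k x → (∀ i → i ≤ k → s i (t (k ∸ i) x) ≈ᴹ c *ₗ s′ i (t′ (k ∸ i) x)) →
                  (s ⊛ t) k x ≈ᴹ c *ₗ (s′ ⊛ t′) k x
  ⊛-termwise-*ₗ c s t s′ t′ k x eq = begin
    (s ⊛ t) k x              ≡⟨ ⊛-unfold s t k x ⟩
    hurwitz s t k x          ≈⟨ ∑-cong-< (suc k) (λ i i<1+k → ≈ᴹ-trans (*ₗ-congˡ (eq i (ℕP.≤-pred i<1+k))) (*ₗ-comm _ c _)) ⟩
    ∑ (suc k) (λ i → c *ₗ _) ≈⟨ *ₗ-distrib-∑ (suc k) c _ ⟨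
    c *ₗ hurwitz s′ t′ k x   ≡⟨ ≡.cong (c *ₗ_) (⊛-unfold s′ t′ k x) ⟨
    c *ₗ (s′ ⊛ t′) k x       ∎

  ⊛-congˡ : ∀ {s s′} t → s ≋ s′ → s ⊛ t ≋ s′ ⊛ t
  ⊛-congˡ {s} {s′} t s≋s′ k x = ⊛-termwise s t s′ t k x (λ i _ → s≋s′ i _)

  ⊛-congʳ : ∀ {s t t′} → IsLinearSeries s → t ≋ t′ → s ⊛ t ≋ s ⊛ t′
  ⊛-congʳ {s} {t} {t′} L t≋t′ k x = ⊛-termwise s t s t′ k x (λ i _ → lin-cong (L i) (t≋t′ _ x))

  ⊛-distribʳ-+S : ∀ s s′ t → (s +S s′) ⊛ t ≋ s ⊛ t +S s′ ⊛ t
  ⊛-distribʳ-+S s s′ t k x = ⊛-termwise-+ (s +S s′) t s t s′ t k x (λ _ _ → ≈ᴹ-refl)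

  ⊛-distribˡ-+S : ∀ s t t′ → IsLinearSeries s → s ⊛ (t +S t′) ≋ s ⊛ t +S s ⊛ t′
  ⊛-distribˡ-+S s t t′ L k x = ⊛-termwise-+ s (t +S t′) s t s t′ k x (λ i _ → lin-+ (L i) _ _)

  ⊛-·ˡ : ∀ c s t → (c ·S s) ⊛ t ≋ c ·S (s ⊛ t)
  ⊛-·ˡ c s t k x = ⊛-termwise-*ₗ c (c ·S s) t s t k x (λ _ _ → ≈ᴹ-refl)

  ⊛-·ʳ : ∀ c s t → IsLinearSeries s → s ⊛ (c ·S t) ≋ c ·S (s ⊛ t)
  ⊛-·ʳ c s t L k x = ⊛-termwise-*ₗ c s (c ·S t) s t k x (λ i _ → lin-*ₗ (L i) c _)

  ⊛-linear : ∀ {s t} → IsLinearSeries s → IsLinearSeries t → IsLinearSeries (s ⊛ t)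
  ⊛-linear Ls Lt k = sumM-linear (suc k) _ (λ i → ·-linear _ (∘-linear (Ls i) (Lt _)))

  ⊛-vanishingʳ : ∀ {s} t k x → IsLinearSeries s → (∀ i → i ≤ k → t i x ≈ᴹ 0ᴹ) → (s ⊛ t) k x ≈ᴹ 0ᴹ
  ⊛-vanishingʳ {s} t k x L t≈0 = ≈ᴹ-trans (≈ᴹ-reflexive (⊛-unfold s t k x))
    (∑-zero (suc k) _ (λ i _ → y≈0⇒x*y≈0 (≈ᴹ-trans (lin-cong (L i) (t≈0 (k ∸ i) (ℕP.m∸n≤m k i))) (lin-0 (L i)))))

  ∘S-⊛ : ∀ {f} → IsLinear f → ∀ s t → (f ∘S s) ⊛ t ≋ f ∘S (s ⊛ t)
  ∘S-⊛ {f} L s t k x = begin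
    ((f ∘S s) ⊛ t) k x                          ≡⟨ ⊛-unfold (f ∘S s) t k x ⟩
    hurwitz (f ∘S s) t k x                      ≈⟨ ∑-cong (suc k) (λ i → lin-*ₗ L _ _) ⟨
    ∑ (suc k) (λ i → f (ι (k C i) *ₗ _))        ≈⟨ lin-∑ L (suc k) _ ⟨
    f (hurwitz s t k x)                         ≡⟨ ≡.cong f (⊛-unfold s t k x) ⟨
    f ((s ⊛ t) k x)                             ∎

  ∂ : Series → Series
  ∂ s k = s (suc k)

  X∂ : Series → Series
  X∂ s k = _·M_ R M (ι k) (s k)

  -- (1 + aX)·d/dX: on divided-power coefficients d/dX shifts the index
  -- and X·d/dX multiplies the k-th coefficient by k.
  Dₐ : Carrier → Series → Series
  Dₐ a s = ∂ s +S a ·S X∂ s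

  ⊛-leibniz : ∀ s t → ∂ (s ⊛ t) ≋ ∂ s ⊛ t +S s ⊛ ∂ t
  ⊛-leibniz s t k x = begin
    (s ⊛ t) (suc k) x                            ≡⟨ ⊛-unfold s t (suc k) x ⟩
    hurwitz s t (suc k) x                        ≈⟨ ∑-unfoldˡ (suc k) _ ⟩
    u₀ +ᴹ ∑ (suc k) (λ i → ι (suc k C suc i) *ₗ s (suc i) (t (k ∸ i) x))
      ≈⟨ +ᴹ-congˡ (∑-cong (suc k) (λ i → ≈ᴹ-trans (*ₗ-congʳ (ι-pascal k i)) (*ₗ-distribʳ _ _ _))) ⟩
    u₀ +ᴹ ∑ (suc k) (λ i → v i +ᴹ w i)           ≈⟨ +ᴹ-congˡ (∑-distrib-+ᴹ (suc k) v w) ⟩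
    u₀ +ᴹ (∑ (suc k) v +ᴹ ∑ (suc k) w)           ≈⟨ +ᴹ-congˡ (+ᴹ-congˡ ∑w≈∑w′) ⟩
    u₀ +ᴹ (∑ (suc k) v +ᴹ ∑ k w′)                ≈⟨ +ᴹ.x∙yz≈y∙xz _ _ _ ⟩
    ∑ (suc k) v +ᴹ (u₀ +ᴹ ∑ k w′)                ≈⟨ +ᴹ-congˡ (∑-unfoldˡ k _) ⟨
    hurwitz (∂ s) t k x +ᴹ hurwitz s (∂ t) k x   ≡⟨ ≡.cong₂ _+ᴹ_ (⊛-unfold (∂ s) t k x) (⊛-unfold s (∂ t) k x) ⟨
    (∂ s ⊛ t) k x +ᴹ (s ⊛ ∂ t) k x               ∎
    where
    u₀ = ι 1 *ₗ s 0 (t (suc k) x)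
    v = λ i → ι (k C i) *ₗ s (suc i) (t (k ∸ i) x)
    w = λ i → ι (k C suc i) *ₗ s (suc i) (t (k ∸ i) x)
    w′ = λ i → ι (k C suc i) *ₗ s (suc i) (t (suc (k ∸ suc i)) x)
    ∑w≈∑w′ : ∑ (suc k) w ≈ᴹ ∑ k w′
    ∑w≈∑w′ = begin
      ∑ k w +ᴹ w k ≈⟨ +ᴹ-congˡ (x≈0⇒x*y≈0 (reflexive (≡.cong ι (k>n⇒nCk≡0 (ℕP.n<1+n k))))) ⟩
      ∑ k w +ᴹ 0ᴹ  ≈⟨ +ᴹ-identityʳ _ ⟩
      ∑ k w        ≈⟨ ∑-cong-< k (λ i i<k → ≈ᴹ-reflexive
                        (≡.cong (λ j → ι (k C suc i) *ₗ s (suc i) (t j x)) (ℕP.+-∸-assoc 1 i<k))) ⟩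
      ∑ k w′       ∎

  ⊛-euler : ∀ s t → IsLinearSeries s → X∂ (s ⊛ t) ≋ X∂ s ⊛ t +S s ⊛ X∂ t
  ⊛-euler s t L k x = begin
    ι k *ₗ (s ⊛ t) k x    ≈⟨ ⊛-·ˡ (ι k) s t k x ⟨
    (ι k ·S s ⊛ t) k x    ≈⟨ ⊛-termwise-+ (ι k ·S s) t (X∂ s) t s (X∂ t) k x split ⟩
    (X∂ s ⊛ t) k x +ᴹ (s ⊛ X∂ t) k x ∎
    where
    split : ∀ i → i ≤ k → ι k *ₗ s i (t (k ∸ i) x) ≈ᴹ ι i *ₗ s i (t (k ∸ i) x) +ᴹ s i (ι (k ∸ i) *ₗ t (k ∸ i) x)
    split i i≤k = begin
      ι k *ₗ y                             ≈⟨ *ₗ-congʳ (reflexive (≡.cong ι (ℕP.m+[n∸m]≡n i≤k))) ⟨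
      ι (i ℕ.+ (k ∸ i)) *ₗ y               ≈⟨ *ₗ-congʳ (ι-homo-+ i (k ∸ i)) ⟩
      (ι i + ι (k ∸ i)) *ₗ y               ≈⟨ *ₗ-distribʳ _ _ _ ⟩
      ι i *ₗ y +ᴹ ι (k ∸ i) *ₗ y           ≈⟨ +ᴹ-congˡ (lin-*ₗ (L i) _ _) ⟨
      ι i *ₗ y +ᴹ s i (ι (k ∸ i) *ₗ t (k ∸ i) x) ∎
      where y = s i (t (k ∸ i) x)

  Dₐ-leibniz : ∀ a s t → IsLinearSeries s → Dₐ a (s ⊛ t) ≋ Dₐ a s ⊛ t +S s ⊛ Dₐ a t
  Dₐ-leibniz a s t L k x = begin
    (s ⊛ t) (suc k) x +ᴹ a *ₗ (ι k *ₗ (s ⊛ t) k x)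
      ≈⟨ +ᴹ-cong (⊛-leibniz s t k x) (≈ᴹ-trans (*ₗ-congˡ (⊛-euler s t L k x)) (*ₗ-distribˡ a _ _)) ⟩
    ((∂ s ⊛ t) k x +ᴹ (s ⊛ ∂ t) k x) +ᴹ (a *ₗ (X∂ s ⊛ t) k x +ᴹ a *ₗ (s ⊛ X∂ t) k x)
      ≈⟨ +ᴹ.interchange _ _ _ _ ⟩
    ((∂ s ⊛ t) k x +ᴹ a *ₗ (X∂ s ⊛ t) k x) +ᴹ ((s ⊛ ∂ t) k x +ᴹ a *ₗ (s ⊛ X∂ t) k x)
      ≈⟨ +ᴹ-cong (+ᴹ-congˡ (⊛-·ˡ a (X∂ s) t k x)) (+ᴹ-congˡ (⊛-·ʳ a s (X∂ t) L k x)) ⟨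
    ((∂ s ⊛ t) k x +ᴹ ((a ·S X∂ s) ⊛ t) k x) +ᴹ ((s ⊛ ∂ t) k x +ᴹ (s ⊛ (a ·S X∂ t)) k x)
      ≈⟨ +ᴹ-cong (⊛-distribʳ-+S (∂ s) (a ·S X∂ s) t k x) (⊛-distribˡ-+S s (∂ t) (a ·S X∂ t) L k x) ⟨
    (Dₐ a s ⊛ t) k x +ᴹ (s ⊛ Dₐ a t) k x ∎

  -- Both sides obey the Leibniz rule for ∂ and agree in degree 0, so induct on the degree.
  ⊛-assoc : ∀ s t u → IsLinearSeries s → s ⊛ (t ⊛ u) ≋ (s ⊛ t) ⊛ u
  ⊛-assoc s t u L zero x = begin
    (s ⊛ (t ⊛ u)) 0 x ≈⟨ ⊛-coeff₀ s (t ⊛ u) x ⟩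
    s 0 ((t ⊛ u) 0 x) ≈⟨ lin-cong (L 0) (⊛-coeff₀ t u x) ⟩
    s 0 (t 0 (u 0 x)) ≈⟨ ⊛-coeff₀ s t (u 0 x) ⟨
    (s ⊛ t) 0 (u 0 x) ≈⟨ ⊛-coeff₀ (s ⊛ t) u x ⟨
    ((s ⊛ t) ⊛ u) 0 x ∎
  ⊛-assoc s t u L (suc k) x = begin
    (s ⊛ (t ⊛ u)) (suc k) x
      ≈⟨ ⊛-leibniz s (t ⊛ u) k x ⟩
    (∂ s ⊛ (t ⊛ u)) k x +ᴹ (s ⊛ ∂ (t ⊛ u)) k x
      ≈⟨ +ᴹ-congˡ (≈ᴹ-trans (⊛-congʳ L (⊛-leibniz t u) k x) (⊛-distribˡ-+S s (∂ t ⊛ u) (t ⊛ ∂ u) L k x)) ⟩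
    (∂ s ⊛ (t ⊛ u)) k x +ᴹ ((s ⊛ (∂ t ⊛ u)) k x +ᴹ (s ⊛ (t ⊛ ∂ u)) k x)
      ≈⟨ +ᴹ-cong (⊛-assoc (∂ s) t u (λ j → L (suc j)) k x)
                 (+ᴹ-cong (⊛-assoc s (∂ t) u L k x) (⊛-assoc s t (∂ u) L k x)) ⟩
    ((∂ s ⊛ t) ⊛ u) k x +ᴹ (((s ⊛ ∂ t) ⊛ u) k x +ᴹ ((s ⊛ t) ⊛ ∂ u) k x)
      ≈⟨ +ᴹ-assoc _ _ _ ⟨
    (((∂ s ⊛ t) ⊛ u) k x +ᴹ ((s ⊛ ∂ t) ⊛ u) k x) +ᴹ ((s ⊛ t) ⊛ ∂ u) k x
      ≈⟨ +ᴹ-congʳ (≈ᴹ-trans (⊛-congˡ u (⊛-leibniz s t) k x) (⊛-distribʳ-+S (∂ s ⊛ t) (s ⊛ ∂ t) u k x)) ⟨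
    (∂ (s ⊛ t) ⊛ u) k x +ᴹ ((s ⊛ t) ⊛ ∂ u) k x
      ≈⟨ ⊛-leibniz (s ⊛ t) u k x ⟨
    ((s ⊛ t) ⊛ u) (suc k) x ∎

  lin-Dₐ : ∀ {f} → IsLinear f → ∀ a s k x → f (Dₐ a s k x) ≈ᴹ Dₐ a (f ∘S s) k x
  lin-Dₐ L a s k x = ≈ᴹ-trans (lin-+ L _ _) (+ᴹ-congˡ (≈ᴹ-trans (lin-*ₗ L _ _) (*ₗ-congˡ (lin-*ₗ L _ _))))

  Dₐ-coeff₀ : ∀ a s x → Dₐ a s 0 x ≈ᴹ s 1 x
  Dₐ-coeff₀ a s x = ≈ᴹ-trans (+ᴹ-congˡ (y≈0⇒x*y≈0 (*ₗ-zeroˡ _))) (+ᴹ-identityʳ _)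

  Dₐ-kernel : ∀ a s → Dₐ a s ≋ zeroS → ∀ j x → s (suc j) x ≈ᴹ 0ᴹ
  Dₐ-kernel a s Ds≋0 zero    x = ≈ᴹ-trans (≈ᴹ-sym (Dₐ-coeff₀ a s x)) (Ds≋0 0 x)
  Dₐ-kernel a s Ds≋0 (suc j) x =
    cancel-zeroʳ (Ds≋0 (suc j) x) (y≈0⇒x*y≈0 (y≈0⇒x*y≈0 (Dₐ-kernel a s Ds≋0 j x)))

  X^[_] : ℕ → Series
  X^[_] = Xpd R M

  oneS : Series
  oneS = constS R M (idM R M)

  X^[]-diag : ∀ l x → X^[ l ] l x ≡ x
  X^[]-diag l x with l ℕ.≡ᵇ l | ℕP.≡⇒≡ᵇ l l ≡.refl
  ... | true | _ = ≡.refl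

  X^[]-off : ∀ l k x → k ≢ l → X^[ l ] k x ≡ 0ᴹ
  X^[]-off l k x k≢l with k ℕ.≡ᵇ l | ℕP.≡ᵇ⇒≡ k l
  ... | true  | k≡l = ⊥-elim (k≢l (k≡l _))
  ... | false | _   = ≡.refl

  X^[]-linear : ∀ l → IsLinearSeries X^[ l ]
  X^[]-linear l k with k ℕ.≡ᵇ l
  ... | true  = id-linear
  ... | false = zero-linear

  X^[]-⊛ : ∀ m t k x → m ≤ k → (X^[ m ] ⊛ t) k x ≈ᴹ ι (k C m) *ₗ t (k ∸ m) x
  X^[]-⊛ m t k x m≤k = begin
    (X^[ m ] ⊛ t) k x                    ≡⟨ ⊛-unfold X^[ m ] t k x ⟩
    hurwitz X^[ m ] t k x                ≈⟨ ∑-single (suc k) _ m (s≤s m≤k) others ⟩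
    ι (k C m) *ₗ X^[ m ] m (t (k ∸ m) x) ≡⟨ ≡.cong (ι (k C m) *ₗ_) (X^[]-diag m _) ⟩
    ι (k C m) *ₗ t (k ∸ m) x             ∎
    where
    others : ∀ i → i < suc k → i ≢ m → ι (k C i) *ₗ X^[ m ] i (t (k ∸ i) x) ≈ᴹ 0ᴹ
    others i _ i≢m = y≈0⇒x*y≈0 (≈ᴹ-reflexive (X^[]-off m i _ i≢m))

  ⊛-X^[] : ∀ s m k x → IsLinearSeries s → m ≤ k → (s ⊛ X^[ m ]) k x ≈ᴹ ι (k C m) *ₗ s (k ∸ m) x
  ⊛-X^[] s m k x L m≤k = begin
    (s ⊛ X^[ m ]) k x                                      ≡⟨ ⊛-unfold s X^[ m ] k x ⟩
    hurwitz s X^[ m ] k x                                  ≈⟨ ∑-single (suc k) _ (k ∸ m) (s≤s (ℕP.m∸n≤m k m)) others ⟩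
    ι (k C (k ∸ m)) *ₗ s (k ∸ m) (X^[ m ] (k ∸ (k ∸ m)) x) ≡⟨ ≡.cong₂ (λ i y → ι i *ₗ s (k ∸ m) y) (≡.sym (nCk≡nC[n∸k] m≤k))
                                                               (≡.trans (≡.cong (λ i → X^[ m ] i x) (ℕP.m∸[m∸n]≡n m≤k)) (X^[]-diag m x)) ⟩
    ι (k C m) *ₗ s (k ∸ m) x                               ∎
    where
    others : ∀ i → i < suc k → i ≢ k ∸ m → ι (k C i) *ₗ s i (X^[ m ] (k ∸ i) x) ≈ᴹ 0ᴹ
    others i i<1+k i≢k∸m = y≈0⇒x*y≈0 (≈ᴹ-trans (lin-cong (L i) (≈ᴹ-reflexive (X^[]-off m (k ∸ i) x
      (λ k∸i≡m → i≢k∸m (≡.trans (≡.sym (ℕP.m∸[m∸n]≡n (ℕP.≤-pred i<1+k))) (≡.cong (k ∸_) k∸i≡m)))))) (lin-0 (L i)))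

  constS-linear : ∀ {f} → IsLinear f → IsLinearSeries (constS R M f)
  constS-linear L zero    = L
  constS-linear L (suc k) = zero-linear

  constS-⊛ : ∀ f t k x → (constS R M f ⊛ t) k x ≈ᴹ f (t k x)
  constS-⊛ f t k x = begin
    (constS R M f ⊛ t) k x                              ≡⟨ ⊛-unfold (constS R M f) t k x ⟩
    hurwitz (constS R M f) t k x                        ≈⟨ ∑-unfoldˡ k _ ⟩
    ι 1 *ₗ f (t k x) +ᴹ ∑ k (λ i → ι (k C suc i) *ₗ 0ᴹ) ≈⟨ +ᴹ-cong (ι1-*ₗ _) (∑-zero k _ (λ i _ → *ₗ-zeroʳ _)) ⟩
    f (t k x) +ᴹ 0ᴹ                                     ≈⟨ +ᴹ-identityʳ _ ⟩
    f (t k x)                                           ∎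

  ⊛-identityʳ : ∀ s → IsLinearSeries s → s ⊛ oneS ≋ s
  ⊛-identityʳ s L k x = ≈ᴹ-trans (⊛-congʳ L oneS≋X^[0] k x) (≈ᴹ-trans (⊛-X^[] s 0 k x L z≤n) (ι1-*ₗ _))
    where
    oneS≋X^[0] : oneS ≋ X^[ 0 ]
    oneS≋X^[0] zero    x = ≈ᴹ-refl
    oneS≋X^[0] (suc k) x = ≈ᴹ-refl

  ±X^[_] : ℕ → Series
  ±X^[ l ] = scalarS R M (sign l) ⊛ X^[ l ]

  ±X^[]-coeff : ∀ l k x → ±X^[ l ] k x ≈ᴹ sign l *ₗ X^[ l ] k x
  ±X^[]-coeff l k x = constS-⊛ (λ y → sign l *ₗ y) X^[ l ] k x

  ±X^[]-off : ∀ l k x → k ≢ l → ±X^[ l ] k x ≈ᴹ 0ᴹ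
  ±X^[]-off l k x k≢l = ≈ᴹ-trans (±X^[]-coeff l k x) (y≈0⇒x*y≈0 (≈ᴹ-reflexive (X^[]-off l k x k≢l)))

  ±X^[]-linear : ∀ l → IsLinearSeries ±X^[ l ]
  ±X^[]-linear l = ⊛-linear (constS-linear (·-linear (sign l) id-linear)) (X^[]-linear l)

  ±X^[]-scale : ∀ l (f : ℕ → Carrier) k x → f k *ₗ ±X^[ l ] k x ≈ᴹ f l *ₗ ±X^[ l ] k x
  ±X^[]-scale l f k x with k ℕ.≟ l
  ... | yes ≡.refl = ≈ᴹ-refl
  ... | no k≢l     = ≈ᴹ-trans (y≈0⇒x*y≈0 (±X^[]-off l k x k≢l)) (≈ᴹ-sym (y≈0⇒x*y≈0 (±X^[]-off l k x k≢l)))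

  ∂-±X^[suc] : ∀ l → ∂ ±X^[ suc l ] ≋ (- 1#) ·S ±X^[ l ]
  ∂-±X^[suc] l k x = begin
    ±X^[ suc l ] (suc k) x             ≈⟨ ±X^[]-coeff (suc l) (suc k) x ⟩
    (sign l * - 1#) *ₗ X^[ l ] k x     ≈⟨ *ₗ-congʳ (*-comm (sign l) (- 1#)) ⟩
    (- 1# * sign l) *ₗ X^[ l ] k x     ≈⟨ *ₗ-assoc _ _ _ ⟩
    (- 1#) *ₗ (sign l *ₗ X^[ l ] k x)  ≈⟨ *ₗ-congˡ (±X^[]-coeff l k x) ⟨
    (- 1#) *ₗ ±X^[ l ] k x             ∎

  module _ (a : Carrier) where
    [1+aX] : Series
    [1+aX] = X^[ 0 ] +S a ·S X^[ 1 ]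

    [1+aX]⁻¹ : Series
    [1+aX]⁻¹ = inv1+aX R M a

    [1+aX]^-[_] : ℕ → Series
    [1+aX]^-[_] = invPow R M a

    inv-coeff : ℕ → Carrier
    inv-coeff j = sign j * (ι (j ℕ.!) * powR R M a j)

    inv-coeff-suc : ∀ j → inv-coeff (suc j) ≈ (sign j * - 1#) * (((1# + ι j) * ι (j ℕ.!)) * (powR R M a j * a))
    inv-coeff-suc j = *-congˡ (*-congʳ (ι-homo-* (suc j) (j ℕ.!)))

    inv-coeff-Dₐ : ∀ j → inv-coeff (suc j) + a * (ι j * inv-coeff j) ≈ (- a) * inv-coeff j
    inv-coeff-Dₐ j = trans (+-congʳ (inv-coeff-suc j))
      (trans (solve 6 (λ P m K F A a → (P :* m) :* (((con 1 :+ K) :* F) :* (A :* a)) :+ a :* (K :* (P :* (F :* A)))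
                                      := (m :* a) :* (P :* (F :* A)) :+ (con 1 :+ m) :* (K :* a :* P :* F :* A))
                    refl (sign j) (- 1#) (ι j) (ι (j ℕ.!)) (powR R M a j) a)
      (trans (trans (+-congˡ ([1+-1]*x≈0 _)) (+-identityʳ _)) (*-congʳ (-1*x≈-x a))))

    inv-coeff-recursion : ∀ j → inv-coeff (suc j) + a * ((1# + ι j) * inv-coeff j) ≈ 0#
    inv-coeff-recursion j = trans (+-congʳ (inv-coeff-suc j))
      (trans (solve 6 (λ P m K F A a → (P :* m) :* (((con 1 :+ K) :* F) :* (A :* a)) :+ a :* ((con 1 :+ K) :* (P :* (F :* A)))
                                      := (con 1 :+ m) :* (a :* (con 1 :+ K) :* P :* F :* A))
                    refl (sign j) (- 1#) (ι j) (ι (j ℕ.!)) (powR R M a j) a)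
      ([1+-1]*x≈0 _))

    inv-coeff₀ : inv-coeff 0 ≈ 1#
    inv-coeff₀ = trans (*-identityˡ _) (trans (*-identityʳ _) (+-identityʳ 1#))

    [1+aX]⁻¹-linear : IsLinearSeries [1+aX]⁻¹
    [1+aX]⁻¹-linear j = ·-linear (inv-coeff j) id-linear

    [1+aX]^-[]-linear : ∀ N → IsLinearSeries [1+aX]^-[ N ]
    [1+aX]^-[]-linear zero    = constS-linear id-linear
    [1+aX]^-[]-linear (suc N) = ⊛-linear ([1+aX]^-[]-linear N) [1+aX]⁻¹-linear

    [1+aX]^-[]-coeff₀ : ∀ N x → [1+aX]^-[ N ] 0 x ≈ᴹ x
    [1+aX]^-[]-coeff₀ zero    x = ≈ᴹ-refl
    [1+aX]^-[]-coeff₀ (suc N) x = ≈ᴹ-trans (⊛-coeff₀ [1+aX]^-[ N ] [1+aX]⁻¹ x)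
      (≈ᴹ-trans ([1+aX]^-[]-coeff₀ N _) (≈ᴹ-trans (*ₗ-congʳ inv-coeff₀) (*ₗ-identityˡ x)))

    Dₐ-[1+aX]⁻¹ : Dₐ a [1+aX]⁻¹ ≋ (- a) ·S [1+aX]⁻¹
    Dₐ-[1+aX]⁻¹ j x = begin
      inv-coeff (suc j) *ₗ x +ᴹ a *ₗ (ι j *ₗ (inv-coeff j *ₗ x)) ≈⟨ +ᴹ-congˡ (*ₗ-assoc₃ _ _ _ x) ⟨
      inv-coeff (suc j) *ₗ x +ᴹ (a * (ι j * inv-coeff j)) *ₗ x   ≈⟨ *ₗ-distribʳ x _ _ ⟨
      (inv-coeff (suc j) + a * (ι j * inv-coeff j)) *ₗ x         ≈⟨ *ₗ-congʳ (inv-coeff-Dₐ j) ⟩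
      ((- a) * inv-coeff j) *ₗ x                                 ≈⟨ *ₗ-assoc _ _ _ ⟩
      (- a) *ₗ (inv-coeff j *ₗ x)                                ∎

    [1+aX]⁻¹-⊛-[1+aX] : [1+aX]⁻¹ ⊛ [1+aX] ≋ oneS
    [1+aX]⁻¹-⊛-[1+aX] k x = begin
      ([1+aX]⁻¹ ⊛ [1+aX]) k x
        ≈⟨ ⊛-distribˡ-+S [1+aX]⁻¹ X^[ 0 ] (a ·S X^[ 1 ]) [1+aX]⁻¹-linear k x ⟩
      ([1+aX]⁻¹ ⊛ X^[ 0 ]) k x +ᴹ ([1+aX]⁻¹ ⊛ (a ·S X^[ 1 ])) k x
        ≈⟨ +ᴹ-cong (≈ᴹ-trans (⊛-X^[] [1+aX]⁻¹ 0 k x [1+aX]⁻¹-linear z≤n) (ι1-*ₗ _))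
                   (⊛-·ʳ a [1+aX]⁻¹ X^[ 1 ] [1+aX]⁻¹-linear k x) ⟩
      [1+aX]⁻¹ k x +ᴹ a *ₗ ([1+aX]⁻¹ ⊛ X^[ 1 ]) k x
        ≈⟨ coefficientwise k ⟩
      oneS k x ∎
      where
      coefficientwise : ∀ k → [1+aX]⁻¹ k x +ᴹ a *ₗ ([1+aX]⁻¹ ⊛ X^[ 1 ]) k x ≈ᴹ oneS k x
      coefficientwise zero = ≈ᴹ-trans
        (+ᴹ-cong (≈ᴹ-trans (*ₗ-congʳ inv-coeff₀) (*ₗ-identityˡ x))
                 (y≈0⇒x*y≈0 (≈ᴹ-trans (⊛-coeff₀ [1+aX]⁻¹ X^[ 1 ] x) (*ₗ-zeroʳ _))))
        (+ᴹ-identityʳ x)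
      coefficientwise (suc j) = begin
        inv-coeff (suc j) *ₗ x +ᴹ a *ₗ ([1+aX]⁻¹ ⊛ X^[ 1 ]) (suc j) x
          ≈⟨ +ᴹ-congˡ (*ₗ-congˡ (⊛-X^[] [1+aX]⁻¹ 1 (suc j) x [1+aX]⁻¹-linear (s≤s z≤n))) ⟩
        inv-coeff (suc j) *ₗ x +ᴹ a *ₗ (ι (suc j C 1) *ₗ (inv-coeff j *ₗ x))
          ≡⟨ ≡.cong (λ i → inv-coeff (suc j) *ₗ x +ᴹ a *ₗ (ι i *ₗ (inv-coeff j *ₗ x))) (nC1≡n (suc j)) ⟩
        inv-coeff (suc j) *ₗ x +ᴹ a *ₗ ((1# + ι j) *ₗ (inv-coeff j *ₗ x))
          ≈⟨ +ᴹ-congˡ (*ₗ-assoc₃ _ _ _ x) ⟨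
        inv-coeff (suc j) *ₗ x +ᴹ (a * ((1# + ι j) * inv-coeff j)) *ₗ x
          ≈⟨ *ₗ-distribʳ x _ _ ⟨
        (inv-coeff (suc j) + a * ((1# + ι j) * inv-coeff j)) *ₗ x
          ≈⟨ x≈0⇒x*y≈0 (inv-coeff-recursion j) ⟩
        0ᴹ ∎

    Dₐ-[1+aX]^-[] : ∀ N → Dₐ a [1+aX]^-[ N ] ≋ (- (ι N * a)) ·S [1+aX]^-[ N ]
    Dₐ-[1+aX]^-[] zero zero x = ≈ᴹ-trans (+ᴹ-identityˡ _) (≈ᴹ-trans (y≈0⇒x*y≈0 (*ₗ-zeroˡ x))
      (≈ᴹ-sym (x≈0⇒x*y≈0 (trans (-‿cong (zeroˡ a)) -0#≈0#))))
    Dₐ-[1+aX]^-[] zero (suc k) x = ≈ᴹ-trans (+ᴹ-identityˡ _) (≈ᴹ-trans (y≈0⇒x*y≈0 (*ₗ-zeroʳ _)) (≈ᴹ-sym (*ₗ-zeroʳ _)))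
    Dₐ-[1+aX]^-[] (suc N) k x = begin
      Dₐ a ([1+aX]^-[ N ] ⊛ [1+aX]⁻¹) k x
        ≈⟨ Dₐ-leibniz a [1+aX]^-[ N ] [1+aX]⁻¹ (G-linear N) k x ⟩
      (Dₐ a [1+aX]^-[ N ] ⊛ [1+aX]⁻¹) k x +ᴹ ([1+aX]^-[ N ] ⊛ Dₐ a [1+aX]⁻¹) k x
        ≈⟨ +ᴹ-cong (⊛-congˡ [1+aX]⁻¹ (Dₐ-[1+aX]^-[] N) k x) (⊛-congʳ (G-linear N) Dₐ-[1+aX]⁻¹ k x) ⟩
      ((- (ι N * a)) ·S [1+aX]^-[ N ] ⊛ [1+aX]⁻¹) k x +ᴹ ([1+aX]^-[ N ] ⊛ ((- a) ·S [1+aX]⁻¹)) k x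
        ≈⟨ +ᴹ-cong (⊛-·ˡ _ [1+aX]^-[ N ] [1+aX]⁻¹ k x) (⊛-·ʳ _ [1+aX]^-[ N ] [1+aX]⁻¹ (G-linear N) k x) ⟩
      (- (ι N * a)) *ₗ y +ᴹ (- a) *ₗ y
        ≈⟨ *ₗ-distribʳ y _ _ ⟨
      ((- (ι N * a)) + (- a)) *ₗ y
        ≈⟨ *ₗ-congʳ (trans (-‿+-comm _ _) (-‿cong (solve 2 (λ K a → K :* a :+ a := (con 1 :+ K) :* a) refl (ι N) a))) ⟩
      (- (ι (suc N) * a)) *ₗ y ∎
      where
      G-linear = [1+aX]^-[]-linear
      y = ([1+aX]^-[ N ] ⊛ [1+aX]⁻¹) k x

    [1+aX]^-[suc]-⊛-[1+aX] : ∀ N → [1+aX]^-[ suc N ] ⊛ [1+aX] ≋ [1+aX]^-[ N ]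
    [1+aX]^-[suc]-⊛-[1+aX] N k x = begin
      (([1+aX]^-[ N ] ⊛ [1+aX]⁻¹) ⊛ [1+aX]) k x ≈⟨ ⊛-assoc [1+aX]^-[ N ] [1+aX]⁻¹ [1+aX] ([1+aX]^-[]-linear N) k x ⟨
      ([1+aX]^-[ N ] ⊛ ([1+aX]⁻¹ ⊛ [1+aX])) k x ≈⟨ ⊛-congʳ ([1+aX]^-[]-linear N) [1+aX]⁻¹-⊛-[1+aX] k x ⟩
      ([1+aX]^-[ N ] ⊛ oneS) k x                ≈⟨ ⊛-identityʳ [1+aX]^-[ N ] ([1+aX]^-[]-linear N) k x ⟩
      [1+aX]^-[ N ] k x                         ∎

    [1+aX]-⊛-±X^[] : ∀ l → [1+aX] ⊛ ±X^[ l ] ≋ ±X^[ l ] +S (- (a * ι (suc l))) ·S ±X^[ suc l ]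
    [1+aX]-⊛-±X^[] l k x = begin
      ([1+aX] ⊛ ±X^[ l ]) k x
        ≈⟨ ⊛-distribʳ-+S X^[ 0 ] (a ·S X^[ 1 ]) ±X^[ l ] k x ⟩
      (X^[ 0 ] ⊛ ±X^[ l ]) k x +ᴹ ((a ·S X^[ 1 ]) ⊛ ±X^[ l ]) k x
        ≈⟨ +ᴹ-cong (≈ᴹ-trans (X^[]-⊛ 0 ±X^[ l ] k x z≤n) (ι1-*ₗ _)) (⊛-·ˡ a X^[ 1 ] ±X^[ l ] k x) ⟩
      ±X^[ l ] k x +ᴹ a *ₗ (X^[ 1 ] ⊛ ±X^[ l ]) k x
        ≈⟨ +ᴹ-congˡ (shifted k) ⟩
      ±X^[ l ] k x +ᴹ (- (a * ι (suc l))) *ₗ ±X^[ suc l ] k x ∎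
      where
      shifted : ∀ k → a *ₗ (X^[ 1 ] ⊛ ±X^[ l ]) k x ≈ᴹ (- (a * ι (suc l))) *ₗ ±X^[ suc l ] k x
      shifted zero = ≈ᴹ-trans (y≈0⇒x*y≈0 (⊛-coeff₀ X^[ 1 ] ±X^[ l ] x))
                              (≈ᴹ-sym (y≈0⇒x*y≈0 (±X^[]-off (suc l) 0 x (λ ()))))
      shifted (suc j) = begin
        a *ₗ (X^[ 1 ] ⊛ ±X^[ l ]) (suc j) x      ≈⟨ *ₗ-congˡ (X^[]-⊛ 1 ±X^[ l ] (suc j) x (s≤s z≤n)) ⟩
        a *ₗ (ι (suc j C 1) *ₗ ±X^[ l ] j x)     ≡⟨ ≡.cong (λ i → a *ₗ (ι i *ₗ ±X^[ l ] j x)) (nC1≡n (suc j)) ⟩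
        a *ₗ (ι (suc j) *ₗ ±X^[ l ] j x)         ≈⟨ *ₗ-congˡ (±X^[]-scale l (λ i → ι (suc i)) j x) ⟩
        a *ₗ (ι (suc l) *ₗ ±X^[ l ] j x)         ≈⟨ *ₗ-assoc _ _ _ ⟨
        (a * ι (suc l)) *ₗ ±X^[ l ] j x          ≈⟨ *ₗ-congʳ (-x*-1≈x _) ⟨
        ((- (a * ι (suc l))) * - 1#) *ₗ ±X^[ l ] j x ≈⟨ *ₗ-assoc _ _ _ ⟩
        (- (a * ι (suc l))) *ₗ ((- 1#) *ₗ ±X^[ l ] j x) ≈⟨ *ₗ-congˡ (∂-±X^[suc] l j x) ⟨
        (- (a * ι (suc l))) *ₗ ±X^[ suc l ] (suc j) x ∎

    Dₐ-±X^[0] : Dₐ a ±X^[ 0 ] ≋ zeroS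
    Dₐ-±X^[0] k x = ≈ᴹ-trans
      (+ᴹ-cong (±X^[]-off 0 (suc k) x (λ ())) (y≈0⇒x*y≈0 (≈ᴹ-trans (±X^[]-scale 0 ι k x) (*ₗ-zeroˡ _))))
      (+ᴹ-identityˡ 0ᴹ)

    Dₐ-±X^[suc] : ∀ l → Dₐ a ±X^[ suc l ] ≋ (- 1#) ·S ±X^[ l ] +S (a * ι (suc l)) ·S ±X^[ suc l ]
    Dₐ-±X^[suc] l k x = +ᴹ-cong (∂-±X^[suc] l k x)
      (≈ᴹ-trans (*ₗ-congˡ (±X^[]-scale (suc l) ι k x)) (≈ᴹ-sym (*ₗ-assoc _ _ _)))

    β : ℕ → ℕ → Series
    β n l = [1+aX]^-[ l ℕ.+ n ] ⊛ ±X^[ l ]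

    β-linear : ∀ n l → IsLinearSeries (β n l)
    β-linear n l = ⊛-linear ([1+aX]^-[]-linear (l ℕ.+ n)) (±X^[]-linear l)

    β-coeff₀ : ∀ n x → β n 0 0 x ≈ᴹ x
    β-coeff₀ n x = ≈ᴹ-trans (⊛-coeff₀ [1+aX]^-[ n ] ±X^[ 0 ] x)
      (≈ᴹ-trans ([1+aX]^-[]-coeff₀ n _) (≈ᴹ-trans (±X^[]-coeff 0 0 x) (*ₗ-identityˡ x)))

    β-below : ∀ n l j x → j < l → β n l j x ≈ᴹ 0ᴹ
    β-below n l j x j<l = ⊛-vanishingʳ ±X^[ l ] j x ([1+aX]^-[]-linear (l ℕ.+ n))
      (λ i i≤j → ±X^[]-off l i x (λ i≡l → ℕP.<-irrefl i≡l (ℕP.≤-<-trans i≤j j<l)))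

    β-step : ∀ n l → β n l ≋ [1+aX]^-[ suc (l ℕ.+ n) ] ⊛ ±X^[ l ] +S (- (a * ι (suc l))) ·S β n (suc l)
    β-step n l k x = begin
      ([1+aX]^-[ l ℕ.+ n ] ⊛ ±X^[ l ]) k x
        ≈⟨ ⊛-congˡ ±X^[ l ] (λ j y → ≈ᴹ-sym ([1+aX]^-[suc]-⊛-[1+aX] (l ℕ.+ n) j y)) k x ⟩
      ((G′ ⊛ [1+aX]) ⊛ ±X^[ l ]) k x
        ≈⟨ ⊛-assoc G′ [1+aX] ±X^[ l ] G′-linear k x ⟨
      (G′ ⊛ ([1+aX] ⊛ ±X^[ l ])) k x
        ≈⟨ ⊛-congʳ G′-linear ([1+aX]-⊛-±X^[] l) k x ⟩
      (G′ ⊛ (±X^[ l ] +S (- (a * ι (suc l))) ·S ±X^[ suc l ])) k x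
        ≈⟨ ⊛-distribˡ-+S G′ ±X^[ l ] ((- (a * ι (suc l))) ·S ±X^[ suc l ]) G′-linear k x ⟩
      (G′ ⊛ ±X^[ l ]) k x +ᴹ (G′ ⊛ ((- (a * ι (suc l))) ·S ±X^[ suc l ])) k x
        ≈⟨ +ᴹ-congˡ (⊛-·ʳ _ G′ ±X^[ suc l ] G′-linear k x) ⟩
      (G′ ⊛ ±X^[ l ]) k x +ᴹ (- (a * ι (suc l))) *ₗ β n (suc l) k x ∎
      where
      G′ = [1+aX]^-[ suc (l ℕ.+ n) ]
      G′-linear = [1+aX]^-[]-linear (suc (l ℕ.+ n))

    Dₐ-β₀ : ∀ n → Dₐ a (β n 0) ≋ (- (ι n * a)) ·S β n 0
    Dₐ-β₀ n k x = begin
      Dₐ a ([1+aX]^-[ n ] ⊛ ±X^[ 0 ]) k x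
        ≈⟨ Dₐ-leibniz a [1+aX]^-[ n ] ±X^[ 0 ] G-linear k x ⟩
      (Dₐ a [1+aX]^-[ n ] ⊛ ±X^[ 0 ]) k x +ᴹ ([1+aX]^-[ n ] ⊛ Dₐ a ±X^[ 0 ]) k x
        ≈⟨ +ᴹ-cong (⊛-congˡ ±X^[ 0 ] (Dₐ-[1+aX]^-[] n) k x)
                   (⊛-vanishingʳ (Dₐ a ±X^[ 0 ]) k x G-linear (λ i _ → Dₐ-±X^[0] i x)) ⟩
      (((- (ι n * a)) ·S [1+aX]^-[ n ]) ⊛ ±X^[ 0 ]) k x +ᴹ 0ᴹ
        ≈⟨ +ᴹ-identityʳ _ ⟩
      (((- (ι n * a)) ·S [1+aX]^-[ n ]) ⊛ ±X^[ 0 ]) k x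
        ≈⟨ ⊛-·ˡ _ [1+aX]^-[ n ] ±X^[ 0 ] k x ⟩
      (- (ι n * a)) *ₗ β n 0 k x ∎
      where G-linear = [1+aX]^-[]-linear n

    Dₐ-β-suc : ∀ n l → Dₐ a (β n (suc l)) ≋ (- (ι (suc l ℕ.+ n) * a)) ·S β n (suc l) +S (- 1#) ·S β n l
    Dₐ-β-suc n l k x = begin
      Dₐ a (G′ ⊛ ±X^[ suc l ]) k x
        ≈⟨ Dₐ-leibniz a G′ ±X^[ suc l ] G′-linear k x ⟩
      (Dₐ a G′ ⊛ ±X^[ suc l ]) k x +ᴹ (G′ ⊛ Dₐ a ±X^[ suc l ]) k x
        ≈⟨ +ᴹ-cong (⊛-congˡ ±X^[ suc l ] (Dₐ-[1+aX]^-[] (suc (l ℕ.+ n))) k x) (⊛-congʳ G′-linear (Dₐ-±X^[suc] l) k x) ⟩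
      ((c ·S G′) ⊛ ±X^[ suc l ]) k x +ᴹ (G′ ⊛ ((- 1#) ·S ±X^[ l ] +S d ·S ±X^[ suc l ])) k x
        ≈⟨ +ᴹ-cong (⊛-·ˡ c G′ ±X^[ suc l ] k x) (⊛-distribˡ-+S G′ ((- 1#) ·S ±X^[ l ]) (d ·S ±X^[ suc l ]) G′-linear k x) ⟩
      c *ₗ β′ +ᴹ ((G′ ⊛ ((- 1#) ·S ±X^[ l ])) k x +ᴹ (G′ ⊛ (d ·S ±X^[ suc l ])) k x)
        ≈⟨ +ᴹ-congˡ (+ᴹ-cong (⊛-·ʳ _ G′ ±X^[ l ] G′-linear k x) (⊛-·ʳ d G′ ±X^[ suc l ] G′-linear k x)) ⟩
      c *ₗ β′ +ᴹ ((- 1#) *ₗ (G′ ⊛ ±X^[ l ]) k x +ᴹ d *ₗ β′)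
        ≈⟨ +ᴹ-congˡ -β≈ ⟨
      c *ₗ β′ +ᴹ (- 1#) *ₗ β n l k x ∎
      where
      G′ = [1+aX]^-[ suc (l ℕ.+ n) ]
      G′-linear = [1+aX]^-[]-linear (suc (l ℕ.+ n))
      β′ = β n (suc l) k x
      c = - (ι (suc l ℕ.+ n) * a)
      d = a * ι (suc l)
      -β≈ : (- 1#) *ₗ β n l k x ≈ᴹ (- 1#) *ₗ (G′ ⊛ ±X^[ l ]) k x +ᴹ d *ₗ β′
      -β≈ = begin
        (- 1#) *ₗ β n l k x                                        ≈⟨ *ₗ-congˡ (β-step n l k x) ⟩
        (- 1#) *ₗ ((G′ ⊛ ±X^[ l ]) k x +ᴹ (- d) *ₗ β′)             ≈⟨ *ₗ-distribˡ _ _ _ ⟩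
        (- 1#) *ₗ (G′ ⊛ ±X^[ l ]) k x +ᴹ (- 1#) *ₗ ((- d) *ₗ β′)   ≈⟨ +ᴹ-congˡ (*ₗ-assoc _ _ _) ⟨
        (- 1#) *ₗ (G′ ⊛ ±X^[ l ]) k x +ᴹ (- 1# * - d) *ₗ β′        ≈⟨ +ᴹ-congˡ (*ₗ-congʳ (trans (-1*x≈-x (- d)) (-‿involutive d))) ⟩
        (- 1#) *ₗ (G′ ⊛ ±X^[ l ]) k x +ᴹ d *ₗ β′                   ∎

    β₀-coeff₁ : ∀ n x → β n 0 1 x ≈ᴹ (- (ι n * a)) *ₗ x
    β₀-coeff₁ n x = ≈ᴹ-trans (≈ᴹ-sym (Dₐ-coeff₀ a (β n 0) x)) (≈ᴹ-trans (Dₐ-β₀ n 0 x) (*ₗ-congˡ (β-coeff₀ n x)))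

    β₁-coeff₁ : ∀ n x → β n 1 1 x ≈ᴹ (- 1#) *ₗ x
    β₁-coeff₁ n x = ≈ᴹ-trans (≈ᴹ-sym (Dₐ-coeff₀ a (β n 1) x)) (≈ᴹ-trans (Dₐ-β-suc n 0 0 x)
      (≈ᴹ-trans (+ᴹ-cong (y≈0⇒x*y≈0 (β-below n 1 0 x (s≤s z≤n))) (*ₗ-congˡ (β-coeff₀ n x))) (+ᴹ-identityˡ _)))

    module _ (φ : ℕ → End R M) where
      Φ : Series
      Φ m = fun (φ m)

      θ : Map R M
      θ = fun (φ 1)

      Φ-linear : IsLinearSeries Φ
      Φ-linear m = End-linear (φ m)

      θ-linear : IsLinear θ
      θ-linear = End-linear (φ 1)

      -- The sum over l stops at j because β n l vanishes below degree l.
      Ψ : ℕ → Series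
      Ψ n j y = ∑ (suc j) (λ l → fun (φ (l ℕ.+ n)) (β n l j y))

      Ψ-coeff₀ : ∀ n x → Ψ n 0 x ≈ᴹ fun (φ n) x
      Ψ-coeff₀ n x = ≈ᴹ-trans (+ᴹ-identityˡ _) (End.cong (φ n) (β-coeff₀ n x))

      Ψ-coeff₁ : ∀ n x → Ψ n 1 x ≈ᴹ (- (ι n * a)) *ₗ fun (φ n) x +ᴹ (- 1#) *ₗ fun (φ (suc n)) x
      Ψ-coeff₁ n x = +ᴹ-cong
        (≈ᴹ-trans (+ᴹ-identityˡ _) (≈ᴹ-trans (End.cong (φ n) (β₀-coeff₁ n x)) (End.*ₗ-hom (φ n) _ _)))
        (≈ᴹ-trans (End.cong (φ (suc n)) (β₁-coeff₁ n x)) (End.*ₗ-hom (φ (suc n)) _ _))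

      Ψ-extend : ∀ n j y → Ψ n j y ≈ᴹ ∑ (suc (suc j)) (λ l → fun (φ (l ℕ.+ n)) (β n l j y))
      Ψ-extend n j y = ≈ᴹ-sym (∑-vanishing-tail _ (ℕP.n≤1+n (suc j))
        (λ l 1+j≤l _ → ≈ᴹ-trans (End.cong (φ (l ℕ.+ n)) (β-below n l j y 1+j≤l)) (lin-0 (End-linear (φ (l ℕ.+ n))))))

      term-coeff : ∀ n l m k x → m ≤ k →
                   term R M a φ n l m k x ≈ᴹ ι (k C m) *ₗ Φ m (fun (φ (l ℕ.+ n)) (β n l (k ∸ m) x))
      term-coeff n l m k x m≤k = begin
        term R M a φ n l m k x
          ≈⟨ constS-⊛ (_∘M_ R M (Φ m) (fun (φ (l ℕ.+ n)))) (G ⊛ (S ⊛ (X^[ l ] ⊛ X^[ m ]))) k x ⟩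
        f ((G ⊛ (S ⊛ (X^[ l ] ⊛ X^[ m ]))) k x)
          ≈⟨ lin-cong f-linear (⊛-congʳ G-linear (⊛-assoc S X^[ l ] X^[ m ] S-linear) k x) ⟩
        f ((G ⊛ ((S ⊛ X^[ l ]) ⊛ X^[ m ])) k x)
          ≈⟨ lin-cong f-linear (⊛-assoc G (S ⊛ X^[ l ]) X^[ m ] G-linear k x) ⟩
        f ((β n l ⊛ X^[ m ]) k x)
          ≈⟨ lin-cong f-linear (⊛-X^[] (β n l) m k x (β-linear n l) m≤k) ⟩
        f (ι (k C m) *ₗ β n l (k ∸ m) x)
          ≈⟨ lin-*ₗ f-linear _ _ ⟩
        ι (k C m) *ₗ f (β n l (k ∸ m) x) ∎
        where
        f = _∘M_ R M (Φ m) (fun (φ (l ℕ.+ n)))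
        f-linear = ∘-linear (Φ-linear m) (End-linear (φ (l ℕ.+ n)))
        G = [1+aX]^-[ l ℕ.+ n ]
        G-linear = [1+aX]^-[]-linear (l ℕ.+ n)
        S = scalarS R M (sign l)
        S-linear = constS-linear (·-linear (sign l) id-linear)

      doubleSum≋Φ⊛Ψ : ∀ n → doubleSum R M (term R M a φ n) ≋ Φ ⊛ Ψ n
      doubleSum≋Φ⊛Ψ n k x = begin
        doubleSum R M (term R M a φ n) k x
          ≡⟨ sumM-≡-∑ (suc k) _ x ⟩
        ∑ (suc k) (λ l → sumM R M (suc (k ∸ l)) (λ m → term R M a φ n l m k) x)
          ≈⟨ ∑-cong (suc k) (λ l → ≈ᴹ-reflexive (sumM-≡-∑ (suc (k ∸ l)) _ x)) ⟩
        ∑ (suc k) (λ l → ∑ (suc (k ∸ l)) (λ m → term R M a φ n l m k x))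
          ≈⟨ ∑-cong (suc k) (λ l → ∑-cong-< (suc (k ∸ l)) (λ m m<1+k∸l →
               term-coeff n l m k x (ℕP.≤-trans (ℕP.≤-pred m<1+k∸l) (ℕP.m∸n≤m k l)))) ⟩
        ∑ (suc k) (λ l → ∑ (suc (k ∸ l)) (λ m → u m l))
          ≈⟨ ∑-cong (suc k) (λ l → ∑-vanishing-tail (λ m → u m l) (s≤s (ℕP.m∸n≤m k l))
               (λ m k∸l<m m<1+k → u-below m l (k∸l<m⇒k∸m<l (ℕP.≤-pred m<1+k) k∸l<m))) ⟨
        ∑ (suc k) (λ l → ∑ (suc k) (λ m → u m l))
          ≈⟨ ∑-comm (suc k) (suc k) (λ l m → u m l) ⟩
        ∑ (suc k) (λ m → ∑ (suc k) (u m))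
          ≈⟨ ∑-cong (suc k) (λ m → ∑-vanishing-tail (u m) (s≤s (ℕP.m∸n≤m k m)) (λ l k∸m<l _ → u-below m l k∸m<l)) ⟩
        ∑ (suc k) (λ m → ∑ (suc (k ∸ m)) (u m))
          ≈⟨ ∑-cong (suc k) (λ m → ≈ᴹ-trans (*ₗ-congˡ (lin-∑ (Φ-linear m) (suc (k ∸ m)) _)) (*ₗ-distrib-∑ (suc (k ∸ m)) _ _)) ⟨
        hurwitz Φ (Ψ n) k x
          ≡⟨ ⊛-unfold Φ (Ψ n) k x ⟨
        (Φ ⊛ Ψ n) k x ∎
        where
        u : ℕ → ℕ → Carrierᴹ
        u m l = ι (k C m) *ₗ Φ m (fun (φ (l ℕ.+ n)) (β n l (k ∸ m) x))
        u-below : ∀ m l → k ∸ m < l → u m l ≈ᴹ 0ᴹ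
        u-below m l k∸m<l = y≈0⇒x*y≈0 (≈ᴹ-trans (End.cong (φ m)
          (≈ᴹ-trans (End.cong (φ (l ℕ.+ n)) (β-below n l (k ∸ m) x k∸m<l)) (lin-0 (End-linear (φ (l ℕ.+ n))))))
          (lin-0 (Φ-linear m)))
        k∸l<m⇒k∸m<l : ∀ {l m} → m ≤ k → k ∸ l < m → k ∸ m < l
        k∸l<m⇒k∸m<l {l} m≤k k∸l<m = ℕP.∸-cancelʳ-< {o = k} (≡.subst (k ∸ l <_) (≡.sym (ℕP.m∸[m∸n]≡n m≤k)) k∸l<m)

      Recurrence : Set (m ⊔ ℓm)
      Recurrence = ∀ q z → Φ (suc q) z ≈ᴹ θ (Φ q z) +ᴹ (- (ι q * a)) *ₗ Φ q z

      prodFactors-linear : ∀ q → IsLinear (prodFactors R M a φ q)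
      prodFactors-linear zero    = id-linear
      prodFactors-linear (suc q) = ∘-linear (prodFactors-linear q) (+-linear θ-linear (·-linear _ id-linear))

      prodFactors-θ : ∀ q y → prodFactors R M a φ q (θ y) ≈ᴹ θ (prodFactors R M a φ q y)
      prodFactors-θ zero    y = ≈ᴹ-refl
      prodFactors-θ (suc q) y = begin
        P (θ (θ y) +ᴹ c *ₗ θ y)   ≈⟨ lin-cong (prodFactors-linear q) (+ᴹ-congˡ (lin-*ₗ θ-linear _ _)) ⟨
        P (θ (θ y) +ᴹ θ (c *ₗ y)) ≈⟨ lin-cong (prodFactors-linear q) (lin-+ θ-linear _ _) ⟨
        P (θ (θ y +ᴹ c *ₗ y))     ≈⟨ prodFactors-θ q _ ⟩
        θ (P (θ y +ᴹ c *ₗ y))     ∎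
        where
        P = prodFactors R M a φ q
        c = - (ι q * a)

      prodFactors-suc : ∀ q z → prodFactors R M a φ (suc q) z ≈ᴹ
                        θ (prodFactors R M a φ q z) +ᴹ (- (ι q * a)) *ₗ prodFactors R M a φ q z
      prodFactors-suc q z = ≈ᴹ-trans (lin-+ (prodFactors-linear q) _ _)
        (+ᴹ-cong (prodFactors-θ q z) (lin-*ₗ (prodFactors-linear q) _ _))

      module _ (φ₀ : ∀ x → fun (φ 0) x ≈ᴹ x) where
        recurrence⇒Φ≈prodFactors : Recurrence → ∀ q z → Φ q z ≈ᴹ prodFactors R M a φ q z
        recurrence⇒Φ≈prodFactors rec zero    z = φ₀ z
        recurrence⇒Φ≈prodFactors rec (suc q) z = ≈ᴹ-trans (rec q z) (≈ᴹ-trans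
          (+ᴹ-cong (lin-cong θ-linear Φq≈Pq) (*ₗ-congˡ Φq≈Pq)) (≈ᴹ-sym (prodFactors-suc q z)))
          where Φq≈Pq = recurrence⇒Φ≈prodFactors rec q z

        recurrence⇒condition2 : Recurrence → Condition2 R M a φ
        recurrence⇒condition2 rec q _ = recurrence⇒Φ≈prodFactors rec q

        condition2⇒recurrence : Condition2 R M a φ → Recurrence
        condition2⇒recurrence cond2 q z = ≈ᴹ-trans (Φ≈P (suc q) z) (≈ᴹ-trans (prodFactors-suc q z)
          (≈ᴹ-sym (+ᴹ-cong (lin-cong θ-linear (Φ≈P q z)) (*ₗ-congˡ (Φ≈P q z)))))
          where
          Φ≈P : ∀ q z → Φ q z ≈ᴹ prodFactors R M a φ q z
          Φ≈P zero    z = φ₀ z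
          Φ≈P (suc q) z = cond2 (suc q) (s≤s z≤n) z

        recurrence⇒Φ-θ-comm : Recurrence → ∀ q z → Φ q (θ z) ≈ᴹ θ (Φ q z)
        recurrence⇒Φ-θ-comm rec q z = ≈ᴹ-trans (Φ≈P q (θ z))
          (≈ᴹ-trans (prodFactors-θ q z) (lin-cong θ-linear (≈ᴹ-sym (Φ≈P q z))))
          where Φ≈P = recurrence⇒Φ≈prodFactors rec

        module _ (rec : Recurrence) where
          Dₐ-Φ : Dₐ a Φ ≋ θ ∘S Φ
          Dₐ-Φ i y = begin
            Φ (suc i) y +ᴹ a *ₗ (ι i *ₗ z)                   ≈⟨ +ᴹ-congʳ (rec i y) ⟩
            (θ z +ᴹ c *ₗ z) +ᴹ a *ₗ (ι i *ₗ z)              ≈⟨ +ᴹ-assoc _ _ _ ⟩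
            θ z +ᴹ (c *ₗ z +ᴹ a *ₗ (ι i *ₗ z))              ≈⟨ +ᴹ-congˡ (+ᴹ-congˡ (*ₗ-assoc a (ι i) z)) ⟨
            θ z +ᴹ (c *ₗ z +ᴹ (a * ι i) *ₗ z)               ≈⟨ +ᴹ-congˡ (*ₗ-distribʳ z _ _) ⟨
            θ z +ᴹ (c + a * ι i) *ₗ z                       ≈⟨ +ᴹ-congˡ (x≈0⇒x*y≈0 (trans (+-congˡ (*-comm a (ι i))) (-‿inverseˡ _))) ⟩
            θ z +ᴹ 0ᴹ                                       ≈⟨ +ᴹ-identityʳ _ ⟩
            θ z                                             ∎
            where
            z = Φ i y
            c = - (ι i * a)

          -θΦ : ∀ q z → (- 1#) *ₗ θ (Φ q z) ≈ᴹ (- 1#) *ₗ Φ (suc q) z +ᴹ (- (ι q * a)) *ₗ Φ q z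
          -θΦ q z = ≈ᴹ-sym (begin
            (- 1#) *ₗ Φ (suc q) z +ᴹ w                       ≈⟨ +ᴹ-congʳ (*ₗ-congˡ (rec q z)) ⟩
            (- 1#) *ₗ (θ (Φ q z) +ᴹ w) +ᴹ w                  ≈⟨ +ᴹ-congʳ (*ₗ-distribˡ _ _ _) ⟩
            ((- 1#) *ₗ θ (Φ q z) +ᴹ (- 1#) *ₗ w) +ᴹ w        ≈⟨ +ᴹ-assoc _ _ _ ⟩
            (- 1#) *ₗ θ (Φ q z) +ᴹ ((- 1#) *ₗ w +ᴹ w)        ≈⟨ +ᴹ-congˡ (≈ᴹ-trans (+ᴹ-comm _ _) (x+-1*ₗx≈0 w)) ⟩
            (- 1#) *ₗ θ (Φ q z) +ᴹ 0ᴹ                        ≈⟨ +ᴹ-identityʳ _ ⟩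
            (- 1#) *ₗ θ (Φ q z)                              ∎)
            where w = (- (ι q * a)) *ₗ Φ q z

          Dₐ-Ψ-termwise : ∀ n j y → Dₐ a (Ψ n) j y ≈ᴹ ∑ (suc (suc j)) (λ l → fun (φ (l ℕ.+ n)) (Dₐ a (β n l) j y))
          Dₐ-Ψ-termwise n j y = begin
            Ψ n (suc j) y +ᴹ a *ₗ (ι j *ₗ Ψ n j y)
              ≈⟨ +ᴹ-congˡ (*ₗ-congˡ (*ₗ-congˡ (Ψ-extend n j y))) ⟩
            ∑ K g′ +ᴹ a *ₗ (ι j *ₗ ∑ K g)
              ≈⟨ +ᴹ-congˡ (≈ᴹ-trans (*ₗ-congˡ (*ₗ-distrib-∑ K _ g)) (*ₗ-distrib-∑ K a _)) ⟩
            ∑ K g′ +ᴹ ∑ K (λ l → a *ₗ (ι j *ₗ g l))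
              ≈⟨ ∑-distrib-+ᴹ K _ _ ⟨
            ∑ K (λ l → g′ l +ᴹ a *ₗ (ι j *ₗ g l))
              ≈⟨ ∑-cong K (λ l → lin-Dₐ (End-linear (φ (l ℕ.+ n))) a (β n l) j y) ⟨
            ∑ K (λ l → fun (φ (l ℕ.+ n)) (Dₐ a (β n l) j y)) ∎
            where
            K = suc (suc j)
            g = λ l → fun (φ (l ℕ.+ n)) (β n l j y)
            g′ = λ l → fun (φ (l ℕ.+ n)) (β n l (suc j) y)

          Dₐ-Ψ : ∀ n → Dₐ a (Ψ n) ≋ (- 1#) ·S (θ ∘S Ψ n)
          Dₐ-Ψ n j y = begin
            Dₐ a (Ψ n) j y
              ≈⟨ Dₐ-Ψ-termwise n j y ⟩
            ∑ K h
              ≈⟨ ∑-unfoldˡ (suc j) h ⟩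
            h 0 +ᴹ ∑ (suc j) (λ l → h (suc l))
              ≈⟨ +ᴹ-cong h₀ (∑-cong (suc j) h-suc) ⟩
            cg 0 +ᴹ ∑ (suc j) (λ l → cg (suc l) +ᴹ mf l)
              ≈⟨ +ᴹ-congˡ (∑-distrib-+ᴹ (suc j) _ _) ⟩
            cg 0 +ᴹ (∑ (suc j) (λ l → cg (suc l)) +ᴹ ∑ (suc j) mf)
              ≈⟨ +ᴹ-assoc _ _ _ ⟨
            (cg 0 +ᴹ ∑ (suc j) (λ l → cg (suc l))) +ᴹ ∑ (suc j) mf
              ≈⟨ +ᴹ-cong (∑-unfoldˡ (suc j) cg) mf-extend ⟨
            ∑ K cg +ᴹ ∑ K mf
              ≈⟨ ≈ᴹ-trans (+ᴹ-comm _ _) (≈ᴹ-sym (∑-distrib-+ᴹ K mf cg)) ⟩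
            ∑ K (λ l → mf l +ᴹ cg l)
              ≈⟨ ∑-cong K (λ l → -θΦ (l ℕ.+ n) (β n l j y)) ⟨
            ∑ K (λ l → (- 1#) *ₗ θ (g l))
              ≈⟨ *ₗ-distrib-∑ K _ _ ⟨
            (- 1#) *ₗ ∑ K (λ l → θ (g l))
              ≈⟨ *ₗ-congˡ (≈ᴹ-trans (lin-cong θ-linear (Ψ-extend n j y)) (lin-∑ θ-linear K g)) ⟨
            (- 1#) *ₗ θ (Ψ n j y) ∎
            where
            K = suc (suc j)
            g = λ l → fun (φ (l ℕ.+ n)) (β n l j y)
            h = λ l → fun (φ (l ℕ.+ n)) (Dₐ a (β n l) j y)
            cg = λ l → (- (ι (l ℕ.+ n) * a)) *ₗ g l
            mf = λ l → (- 1#) *ₗ fun (φ (suc l ℕ.+ n)) (β n l j y)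
            φ-linear = λ l → End-linear (φ (l ℕ.+ n))
            h₀ : h 0 ≈ᴹ cg 0
            h₀ = ≈ᴹ-trans (lin-cong (φ-linear 0) (Dₐ-β₀ n j y)) (lin-*ₗ (φ-linear 0) _ _)
            h-suc : ∀ l → h (suc l) ≈ᴹ cg (suc l) +ᴹ mf l
            h-suc l = ≈ᴹ-trans (lin-cong (φ-linear (suc l)) (Dₐ-β-suc n l j y)) (≈ᴹ-trans (lin-+ (φ-linear (suc l)) _ _)
              (+ᴹ-cong (lin-*ₗ (φ-linear (suc l)) _ _) (lin-*ₗ (φ-linear (suc l)) _ _)))
            mf-extend : ∑ K mf ≈ᴹ ∑ (suc j) mf
            mf-extend = ≈ᴹ-trans (+ᴹ-congˡ (y≈0⇒x*y≈0 (≈ᴹ-trans (lin-cong (φ-linear (suc (suc j)))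
              (β-below n (suc j) j y (ℕP.n<1+n j))) (lin-0 (φ-linear (suc (suc j))))))) (+ᴹ-identityʳ _)

          Dₐ-Φ⊛Ψ : ∀ n → Dₐ a (Φ ⊛ Ψ n) ≋ zeroS
          Dₐ-Φ⊛Ψ n k x = begin
            Dₐ a (Φ ⊛ Ψ n) k x
              ≈⟨ Dₐ-leibniz a Φ (Ψ n) Φ-linear k x ⟩
            (Dₐ a Φ ⊛ Ψ n) k x +ᴹ (Φ ⊛ Dₐ a (Ψ n)) k x
              ≈⟨ +ᴹ-cong (⊛-congˡ (Ψ n) Dₐ-Φ k x) (⊛-congʳ Φ-linear (Dₐ-Ψ n) k x) ⟩
            ((θ ∘S Φ) ⊛ Ψ n) k x +ᴹ (Φ ⊛ ((- 1#) ·S (θ ∘S Ψ n))) k x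
              ≈⟨ +ᴹ-cong (∘S-⊛ θ-linear Φ (Ψ n) k x) (⊛-·ʳ (- 1#) Φ (θ ∘S Ψ n) Φ-linear k x) ⟩
            θ ((Φ ⊛ Ψ n) k x) +ᴹ (- 1#) *ₗ (Φ ⊛ (θ ∘S Ψ n)) k x
              ≈⟨ +ᴹ-congˡ (*ₗ-congˡ (⊛-termwise Φ (θ ∘S Ψ n) (θ ∘S Φ) (Ψ n) k x (λ i _ → recurrence⇒Φ-θ-comm rec i _))) ⟩
            θ ((Φ ⊛ Ψ n) k x) +ᴹ (- 1#) *ₗ ((θ ∘S Φ) ⊛ Ψ n) k x
              ≈⟨ +ᴹ-congˡ (*ₗ-congˡ (∘S-⊛ θ-linear Φ (Ψ n) k x)) ⟩
            θ ((Φ ⊛ Ψ n) k x) +ᴹ (- 1#) *ₗ θ ((Φ ⊛ Ψ n) k x)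
              ≈⟨ x+-1*ₗx≈0 _ ⟩
            0ᴹ ∎

        recurrence⇒condition1 : Recurrence → Condition1 R M a φ
        recurrence⇒condition1 rec n k x = ≈ᴹ-sym (≈ᴹ-trans (doubleSum≋Φ⊛Ψ n k x) (coefficient k))
          where
          coefficient : ∀ k → (Φ ⊛ Ψ n) k x ≈ᴹ constS R M (fun (φ n)) k x
          coefficient zero    = ≈ᴹ-trans (⊛-coeff₀ Φ (Ψ n) x) (≈ᴹ-trans (φ₀ _) (Ψ-coeff₀ n x))
          coefficient (suc j) = Dₐ-kernel a (Φ ⊛ Ψ n) (Dₐ-Φ⊛Ψ rec n) j x

        condition1⇒recurrence : Condition1 R M a φ → Recurrence
        condition1⇒recurrence cond1 n x = 0≈p-v+t⇒v≈t+p (begin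
          0ᴹ                                         ≈⟨ cond1 n 1 x ⟩
          doubleSum R M (term R M a φ n) 1 x         ≈⟨ doubleSum≋Φ⊛Ψ n 1 x ⟩
          (Φ ⊛ Ψ n) 1 x                              ≈⟨ ⊛-coeff₁ Φ (Ψ n) x ⟩
          Φ 0 (Ψ n 1 x) +ᴹ θ (Ψ n 0 x)               ≈⟨ +ᴹ-cong (≈ᴹ-trans (φ₀ _) (Ψ-coeff₁ n x)) (lin-cong θ-linear (Ψ-coeff₀ n x)) ⟩
          ((- (ι n * a)) *ₗ Φ n x +ᴹ (- 1#) *ₗ Φ (suc n) x) +ᴹ θ (Φ n x) ∎)

-- Primality of p and p-completeness of M go unused: each coefficient of both sides of (1)
-- is a finite sum, so the identity is checked degree by degree without any limits.
proposition3p7 : {r ℓr m ℓm : Level} (R : CommutativeRing r ℓr) (M : Module R m ℓm)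
    (p : ℕ) → Prime p → IsPComplete R M p →
    (a : CommutativeRing.Carrier R) (φ : ℕ → End R M) →
    (∀ x → Module._≈ᴹ_ M (End.fun (φ 0) x) x) →
    (Condition1 R M a φ → Condition2 R M a φ) × (Condition2 R M a φ → Condition1 R M a φ)
proposition3p7 R M _ _ _ a φ φ₀ =
    (λ cond1 → recurrence⇒condition2 R M a φ φ₀ (condition1⇒recurrence R M a φ φ₀ cond1))
  , (λ cond2 → recurrence⇒condition1 R M a φ φ₀ (condition2⇒recurrence R M a φ φ₀ cond2))
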